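{- Let $(t_n)_{n\ge0}$ be the Thue–Morse sequence. Let $L_J$ be the set of binary words $w_{n-1}\cdots w_0$ (leading zeroes allowed) such that there is no index $i\in\{0,\dots,n-2\}$ with $w_{i+1}=1$, $w_i=0$ and $t_i=0$, and let $u_n$ be the number of words of length $n$ in $L_J$. Then $u_0=1$, $u_1=2$, $u_2=3$, and for all $n\ge3$: $u_n=2u_{n-1}$ if $t_{n-2}=1$; $u_n=u_{n-1}+u_{n-3}$ if $t_{n-2}=t_{n-3}=0$; and $u_n=u_{n-1}+u_{n-2}$ if $t_{n-2}=0$ and $t_{n-3}=1$.
   Context: The Thue–Morse sequence is defined by $t_n=$ (number of $1$'s in the binary expansion of $n$) mod $2$; so $t=0110100110010110\cdots$. -}

module Defs where

open import Data.Nat using (ℕ; zero; suc; _+_; _%_; _/_; _<_)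
open import Data.Bool using (Bool; true; false)
open import Data.Fin using (Fin; toℕ)
open import Data.Vec using (Vec; []; _∷_; lookup)
open import Data.List using (List; []; _∷_; _++_; map; length; filter)
open import Data.Product using (Σ; _×_; ∃)
open import Relation.Binary.PropositionalEquality using (_≡_)
open import Relation.Nullary using (¬_; Dec)

-- number of 1's in the binary expansion of n; `fuel` bounds the number of
-- halvings (fuel = n suffices, since n has at most n binary digits).
popcountAux : ℕ → ℕ → ℕ
popcountAux zero    n = 0
popcountAux (suc f) n = n % 2 + popcountAux f (n / 2)

popcount : ℕ → ℕ
popcount n = popcountAux n n

t : ℕ → ℕ
t n = popcount n % 2

-- A binary word w_{n-1} ... w_0 of length n is a Vec Bool n; the letter w_i
-- (i = 0 the rightmost/least significant letter) is `letter w i`.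
letter : ∀ {n} → Vec Bool n → Fin n → Bool
letter w i = lookup w i

InLJ : ∀ {n} → Vec Bool n → Set
InLJ {n} w = ¬ (Σ (Fin n) λ j → Σ (Fin n) λ i →
                 (toℕ j ≡ suc (toℕ i)) × (letter w j ≡ true) ×
                 (letter w i ≡ false) × (t (toℕ i) ≡ 0))

allWords : (n : ℕ) → List (Vec Bool n)
allWords zero    = [] ∷ []
allWords (suc n) = map (false ∷_) (allWords n) ++ map (true ∷_) (allWords n)

-- Counting needs a decision
-- procedure for membership; it is taken as a parameter (InLJ is a
-- proposition, so the count does not depend on the chosen decider).
DecLJ : Set
DecLJ = ∀ {n} (w : Vec Bool n) → Dec (InLJ w)

u : DecLJ → ℕ → ℕ
u d n = length (filter d (allWords n))

-- Whether a letter may be appended to a word avoiding the rises w_i = 0, w_(i+1) = 1 at positions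
-- with τ_i = 0 depends only on the last letter and on τ at the last position. So if U n counts
-- the valid words of length n and E n those of length n + 2 ending in 1, then
-- U (n + 2) = U (n + 1) + E n since a 0 can always be appended, E n = U (n + 1) when τ_n ≠ 0,
-- and E (n + 1) = E n when τ_(n+1) = 0 since the word must then end in 11. The Thue–Morse
-- sequence satisfies t (2k) ≠ t (2k + 1), so it never vanishes three times in a row, and the
-- three cases of the recurrence follow.
module Submission where

open import Defs
open import Data.Nat using (ℕ; zero; suc; _+_; _*_; _%_; _/_; _≤_; s≤s)
open import Data.Nat.Properties using (≤-trans; ≤-refl; ≤-pred; n<1+n; +-identityʳ; +-commutativeSemigroup; suc-injective)
open import Data.Nat.DivMod using (m/n<m; m*n%n≡0; [m+kn]%n≡m%n; +-distrib-/-∣ʳ; %-pred-≡0)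
open import Data.Nat.Divisibility using (n∣m*n)
open import Data.Bool using (Bool; true; false; _∧_; T)
open import Data.Bool.Properties using (∧-assoc; ∧-identityʳ; ∧-zeroʳ; T-∧)
open import Data.Fin using (Fin; toℕ; zero; suc)
open import Data.Vec using (Vec; []; _∷_; _∷ʳ_; last; lookup)
open import Data.Vec.Properties using (last-∷ʳ)
open import Data.List using ([]; _∷_; _++_; map; length; filterᵇ)
open import Data.List.Properties using (filter-++; filter-≐; filter-none; length-++)
open import Data.List.Relation.Unary.All using (universal)
open import Data.Product using (_×_; Σ; _,_; proj₂)
open import Data.Unit using (tt)
open import Data.Empty using (⊥)
open import Function using (_∘_; const)
open import Function.Bundles using (Equivalence)
open import Relation.Binary.PropositionalEquality
open import Relation.Nullary using (¬_)
open import Relation.Nullary.Decidable using (T?)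
open import Relation.Unary using (_≐_)
open import Algebra.Properties.CommutativeSemigroup +-commutativeSemigroup using (interchange)

private
  variable
    n : ℕ

[1+n]/2≤n : ∀ n → suc n / 2 ≤ n
[1+n]/2≤n n = ≤-pred (m/n<m (suc n) 2 (n<1+n 1))

popcountAux-zero : ∀ f → popcountAux f 0 ≡ 0
popcountAux-zero zero    = refl
popcountAux-zero (suc f) = popcountAux-zero f

popcountAux-fuel : ∀ {f g n} → n ≤ f → n ≤ g → popcountAux f n ≡ popcountAux g n
popcountAux-fuel {f} {g} {zero} _ _ = trans (popcountAux-zero f) (sym (popcountAux-zero g))
popcountAux-fuel {suc f} {suc g} {suc n} (s≤s n≤f) (s≤s n≤g) =
  cong (suc n % 2 +_) (popcountAux-fuel (≤-trans ([1+n]/2≤n n) n≤f) (≤-trans ([1+n]/2≤n n) n≤g))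

popcount-unfold : ∀ n → popcount n ≡ n % 2 + popcount (n / 2)
popcount-unfold zero    = refl
popcount-unfold (suc n) = cong (suc n % 2 +_) (popcountAux-fuel ([1+n]/2≤n n) ≤-refl)

popcount-suc-even : ∀ k → popcount (suc (k * 2)) ≡ suc (popcount (k * 2))
popcount-suc-even k = begin
  popcount (suc (k * 2))                ≡⟨ popcount-unfold (suc (k * 2)) ⟩
  suc (k * 2) % 2 + popcount (suc (k * 2) / 2)
    ≡⟨ cong₂ _+_ ([m+kn]%n≡m%n 1 k 2) (cong popcount (+-distrib-/-∣ʳ 1 (n∣m*n k {2}))) ⟩
  suc (popcount (k * 2 / 2))            ≡⟨ cong (λ r → suc (r + popcount (k * 2 / 2))) (m*n%n≡0 k 2) ⟨
  suc (k * 2 % 2 + popcount (k * 2 / 2)) ≡⟨ cong suc (popcount-unfold (k * 2)) ⟨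
  suc (popcount (k * 2))                ∎
  where open ≡-Reasoning

t-suc-even : ∀ k → t (suc (k * 2)) ≡ 0 → t (k * 2) ≡ 1
t-suc-even k t≡0 = %-pred-≡0 {popcount (k * 2)} (trans (cong (_% 2) (sym (popcount-suc-even k))) t≡0)

data Parity : ℕ → Set where
  even : ∀ k → Parity (k * 2)
  odd  : ∀ k → Parity (suc (k * 2))

parity : ∀ m → Parity m
parity zero = even 0
parity (suc m) with parity m
... | even k = odd k
... | odd  k = even (suc k)

t-no-000 : ∀ m → t (1 + m) ≡ 0 → t (2 + m) ≡ 0 → t m ≡ 1
t-no-000 m t₁≡0 t₂≡0 with parity m
... | even k = t-suc-even k t₁≡0
... | odd  k with () ← trans (sym t₁≡0) (t-suc-even (suc k) t₂≡0)

-- InLJ w unfolds to ¬ ForbiddenRise t w.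
ForbiddenRise : (ℕ → ℕ) → Vec Bool n → Set
ForbiddenRise {n} τ w = Σ (Fin n) λ j → Σ (Fin n) λ i →
  (toℕ j ≡ suc (toℕ i)) × (lookup w j ≡ true) × (lookup w i ≡ false) × (τ (toℕ i) ≡ 0)

allowed : Bool → Bool → ℕ → Bool
allowed _ false _       = true
allowed _ true  (suc _) = true
allowed b true  zero    = b

valid : (ℕ → ℕ) → Vec Bool n → Bool
valid τ []          = true
valid τ (b ∷ [])    = true
valid τ (b ∷ c ∷ w) = allowed b c (τ 0) ∧ valid (τ ∘ suc) (c ∷ w)

allowed-complete : ∀ b c x → (b ≡ false → c ≡ true → x ≡ 0 → ⊥) → T (allowed b c x)
allowed-complete _     false _       _   = tt
allowed-complete _     true  (suc _) _   = tt
allowed-complete true  true  zero    _   = tt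
allowed-complete false true  zero    rise = rise refl refl refl

valid-sound : ∀ τ (w : Vec Bool n) → T (valid τ w) → ¬ ForbiddenRise τ w
valid-sound τ (b ∷ []) _ (zero , _ , () , _)
valid-sound τ (b ∷ c ∷ w) _ (zero , _ , () , _)
valid-sound τ (b ∷ c ∷ w) _ (suc (suc j) , zero , () , _)
valid-sound τ (b ∷ c ∷ w) ok (suc zero , zero , _ , refl , refl , τ₀≡0) =
  subst (λ x → T (allowed false true x ∧ valid (τ ∘ suc) (true ∷ w))) τ₀≡0 ok
valid-sound τ (b ∷ c ∷ w) ok (suc j , suc i , j≡1+i , rise) =
  valid-sound (τ ∘ suc) (c ∷ w) (proj₂ (Equivalence.to (T-∧ {allowed b c (τ 0)}) ok))
    (j , i , suc-injective j≡1+i , rise)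

valid-complete : ∀ τ (w : Vec Bool n) → ¬ ForbiddenRise τ w → T (valid τ w)
valid-complete τ []          _ = tt
valid-complete τ (b ∷ [])    _ = tt
valid-complete τ (b ∷ c ∷ w) noRise = Equivalence.from T-∧
  ( allowed-complete b c (τ 0) (λ { refl refl τ₀≡0 → noRise (suc zero , zero , refl , refl , refl , τ₀≡0) })
  , valid-complete (τ ∘ suc) (c ∷ w) (λ (j , i , j≡1+i , rise) → noRise (suc j , suc i , cong suc j≡1+i , rise)))

valid-∷ʳ : ∀ τ (w : Vec Bool (suc n)) c → valid τ (w ∷ʳ c) ≡ valid τ w ∧ allowed (last w) c (τ n)
valid-∷ʳ τ (b ∷ [])     c = ∧-identityʳ (allowed b c (τ 0))
valid-∷ʳ τ (b ∷ b′ ∷ w) c = trans (cong (allowed b b′ (τ 0) ∧_) (valid-∷ʳ (τ ∘ suc) (b′ ∷ w) c))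
                                  (sym (∧-assoc (allowed b b′ (τ 0)) _ _))

length-filterᵇ-map : ∀ {A B : Set} (p : B → Bool) (f : A → B) xs →
  length (filterᵇ p (map f xs)) ≡ length (filterᵇ (p ∘ f) xs)
length-filterᵇ-map p f [] = refl
length-filterᵇ-map p f (x ∷ xs) with p (f x)
... | true  = cong suc (length-filterᵇ-map p f xs)
... | false = length-filterᵇ-map p f xs

count : (Vec Bool n → Bool) → ℕ
count {n} p = length (filterᵇ p (allWords n))

count-cong : {p q : Vec Bool n → Bool} → p ≗ q → count p ≡ count q
count-cong {n} {p} {q} p≗q = cong length
  (filter-≐ (T? ∘ p) (T? ∘ q) ((λ {w} → subst T (p≗q w)) , (λ {w} → subst T (sym (p≗q w)))) (allWords n))

count-false : count {n} (const false) ≡ 0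
count-false {n} = cong length (filter-none (T? ∘ const false) (universal (λ _ ()) (allWords n)))

count-∷ : (p : Vec Bool (suc n) → Bool) → count p ≡ count (p ∘ (false ∷_)) + count (p ∘ (true ∷_))
count-∷ {n} p = begin
  length (filterᵇ p (map (false ∷_) (allWords n) ++ map (true ∷_) (allWords n)))
    ≡⟨ cong length (filter-++ (T? ∘ p) (map (false ∷_) (allWords n)) _) ⟩
  length (filterᵇ p (map (false ∷_) (allWords n)) ++ filterᵇ p (map (true ∷_) (allWords n)))
    ≡⟨ length-++ (filterᵇ p (map (false ∷_) (allWords n))) ⟩
  length (filterᵇ p (map (false ∷_) (allWords n))) + length (filterᵇ p (map (true ∷_) (allWords n)))
    ≡⟨ cong₂ _+_ (length-filterᵇ-map p (false ∷_) (allWords n)) (length-filterᵇ-map p (true ∷_) (allWords n)) ⟩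
  count (p ∘ (false ∷_)) + count (p ∘ (true ∷_)) ∎
  where open ≡-Reasoning

count-∷ʳ : (p : Vec Bool (suc n) → Bool) → count p ≡ count (p ∘ (_∷ʳ false)) + count (p ∘ (_∷ʳ true))
count-∷ʳ {zero} p = trans (count-∷ p)
  (cong₂ _+_ (count-cong {0} {p ∘ (false ∷_)} {p ∘ (_∷ʳ false)} λ { [] → refl })
             (count-cong {0} {p ∘ (true ∷_)} {p ∘ (_∷ʳ true)} λ { [] → refl }))
count-∷ʳ {suc n} p = begin
  count p                                       ≡⟨ count-∷ p ⟩
  count (p ∘ (false ∷_)) + count (p ∘ (true ∷_)) ≡⟨ cong₂ _+_ (count-∷ʳ (p ∘ (false ∷_))) (count-∷ʳ (p ∘ (true ∷_))) ⟩
  (c false false + c false true) + (c true false + c true true)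
    ≡⟨ interchange (c false false) (c false true) (c true false) (c true true) ⟩
  (c false false + c true false) + (c false true + c true true)
    ≡⟨ cong₂ _+_ (count-∷ (p ∘ (_∷ʳ false))) (count-∷ (p ∘ (_∷ʳ true))) ⟨
  count (p ∘ (_∷ʳ false)) + count (p ∘ (_∷ʳ true)) ∎
  where
  open ≡-Reasoning
  c : Bool → Bool → ℕ
  c first final = count {n} (λ w → p (first ∷ (w ∷ʳ final)))

count-last : (p : Vec Bool (suc n) → Bool) → count (λ w → p w ∧ last w) ≡ count (p ∘ (_∷ʳ true))
count-last {n} p = begin
  count (λ w → p w ∧ last w)
    ≡⟨ count-∷ʳ {n} _ ⟩
  count (λ w → p (w ∷ʳ false) ∧ last (w ∷ʳ false)) + count (λ w → p (w ∷ʳ true) ∧ last (w ∷ʳ true))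
    ≡⟨ cong₂ _+_ (trans (count-cong endsIn0) (count-false {n})) (count-cong endsIn1) ⟩
  count (p ∘ (_∷ʳ true)) ∎
  where
  open ≡-Reasoning
  endsIn0 : ∀ w → p (w ∷ʳ false) ∧ last (w ∷ʳ false) ≡ false
  endsIn0 w = trans (cong (p (w ∷ʳ false) ∧_) (last-∷ʳ false w)) (∧-zeroʳ _)
  endsIn1 : ∀ w → p (w ∷ʳ true) ∧ last (w ∷ʳ true) ≡ p (w ∷ʳ true)
  endsIn1 w = trans (cong (p (w ∷ʳ true) ∧_) (last-∷ʳ true w)) (∧-identityʳ _)

#valid : (ℕ → ℕ) → ℕ → ℕ
#valid τ n = count {n} (valid τ)

#validEndingIn1 : (ℕ → ℕ) → ℕ → ℕ
#validEndingIn1 τ n = count {suc n} (λ w → valid τ (w ∷ʳ true))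

#valid-suc : ∀ τ n → #valid τ (2 + n) ≡ #valid τ (1 + n) + #validEndingIn1 τ n
#valid-suc τ n = trans (count-∷ʳ {suc n} (valid τ))
  (cong (_+ #validEndingIn1 τ n) (count-cong {suc n} λ w → trans (valid-∷ʳ τ w false) (∧-identityʳ (valid τ w))))

#validEndingIn1-free : ∀ τ n {m} → τ n ≡ suc m → #validEndingIn1 τ n ≡ #valid τ (1 + n)
#validEndingIn1-free τ n τₙ≡1+m = count-cong λ w → begin
  valid τ (w ∷ʳ true)                       ≡⟨ valid-∷ʳ τ w true ⟩
  valid τ w ∧ allowed (last w) true (τ n)   ≡⟨ cong (λ x → valid τ w ∧ allowed (last w) true x) τₙ≡1+m ⟩
  valid τ w ∧ true                          ≡⟨ ∧-identityʳ (valid τ w) ⟩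
  valid τ w                                 ∎
  where open ≡-Reasoning

#validEndingIn1-forced : ∀ τ n → τ (suc n) ≡ 0 → #validEndingIn1 τ (suc n) ≡ #validEndingIn1 τ n
#validEndingIn1-forced τ n τ₁₊ₙ≡0 = trans (count-cong forced) (count-last {suc n} (valid τ))
  where
  forced : (w : Vec Bool (2 + n)) → valid τ (w ∷ʳ true) ≡ valid τ w ∧ last w
  forced w = trans (valid-∷ʳ τ w true) (cong (λ x → valid τ w ∧ allowed (last w) true x) τ₁₊ₙ≡0)

u≡#valid : (d : DecLJ) → ∀ n → u d n ≡ #valid t n
u≡#valid d n = cong length (filter-≐ d (T? ∘ valid t) InLJ≐valid (allWords n))
  where
  InLJ≐valid : InLJ ≐ (T ∘ valid t)
  InLJ≐valid = (λ {w} → valid-complete t w) , (λ {w} → valid-sound t w)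

#validEndingIn1-t00 : ∀ n → t (suc n) ≡ 0 → t n ≡ 0 → #validEndingIn1 t n ≡ #valid t n
#validEndingIn1-t00 zero    ()
#validEndingIn1-t00 (suc m) t₂₊ₘ≡0 t₁₊ₘ≡0 =
  trans (#validEndingIn1-forced t m t₁₊ₘ≡0) (#validEndingIn1-free t m (t-no-000 m t₁₊ₘ≡0 t₂₊ₘ≡0))

lemma3 : (d : DecLJ) →
    (u d 0 ≡ 1) × (u d 1 ≡ 2) × (u d 2 ≡ 3) ×
    ((n : ℕ) →
      ((t (suc n) ≡ 1 → u d (3 + n) ≡ 2 * u d (2 + n)) ×
       (t (suc n) ≡ 0 → t n ≡ 0 → u d (3 + n) ≡ u d (2 + n) + u d n) ×
       (t (suc n) ≡ 0 → t n ≡ 1 → u d (3 + n) ≡ u d (2 + n) + u d (suc n))))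
lemma3 d = u≡#valid d 0 , u≡#valid d 1 , u≡#valid d 2 , λ n → recurrence-1 n , recurrence-00 n , recurrence-01 n
  where
  recurrence-1 : ∀ n → t (suc n) ≡ 1 → u d (3 + n) ≡ 2 * u d (2 + n)
  recurrence-1 n t₁₊ₙ≡1 rewrite u≡#valid d (3 + n) | u≡#valid d (2 + n) =
    trans (#valid-suc t (1 + n)) (cong (#valid t (2 + n) +_)
      (trans (#validEndingIn1-free t (1 + n) t₁₊ₙ≡1) (sym (+-identityʳ (#valid t (2 + n))))))
  recurrence-00 : ∀ n → t (suc n) ≡ 0 → t n ≡ 0 → u d (3 + n) ≡ u d (2 + n) + u d n
  recurrence-00 n t₁₊ₙ≡0 tₙ≡0 rewrite u≡#valid d (3 + n) | u≡#valid d (2 + n) | u≡#valid d n =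
    trans (#valid-suc t (1 + n)) (cong (#valid t (2 + n) +_)
      (trans (#validEndingIn1-forced t n t₁₊ₙ≡0) (#validEndingIn1-t00 n t₁₊ₙ≡0 tₙ≡0)))
  recurrence-01 : ∀ n → t (suc n) ≡ 0 → t n ≡ 1 → u d (3 + n) ≡ u d (2 + n) + u d (suc n)
  recurrence-01 n t₁₊ₙ≡0 tₙ≡1 rewrite u≡#valid d (3 + n) | u≡#valid d (2 + n) | u≡#valid d (suc n) =
    trans (#valid-suc t (1 + n)) (cong (#valid t (2 + n) +_)
      (trans (#validEndingIn1-forced t n t₁₊ₙ≡0) (#validEndingIn1-free t n tₙ≡1)))
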